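{- Let $G$ be a graph with $n$ vertices and $t$ triangles. Sample $U\subseteq V$ by adding each vertex independently with probability $p$, and let $F=G[U]$. If $p\ge 1/t$, then $F$ contains a triangle with probability at least $p^2/3$.
   Context: $G[U]$ is the subgraph of $G$ induced by $U$.
   Formalization: The probability p with which each vertex is added is a rational number in [0,1]. -}

module Defs where

open import Data.Bool using (Bool; true; false; _∧_; _∨_; if_then_else_)
open import Data.Nat as ℕ using (ℕ; zero; suc)
open import Data.Fin using (Fin; _<?_)

open import Data.Vec using (Vec; []; _∷_; lookup)
open import Data.List using (List; []; _∷_; map; _++_; length; filterᵇ; concatMap; foldr)
open import Data.List using () renaming (allFin to allFinL)
open import Data.Product using (_×_; _,_)
open import Relation.Nullary.Decidable using (⌊_⌋)
open import Relation.Binary.PropositionalEquality using (_≡_)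
open import Data.Integer using (+_)
open import Data.Rational using (ℚ; 0ℚ; 1ℚ; _+_; _*_; _-_)

record Graph (n : ℕ) : Set where
  field
    adj   : Fin n → Fin n → Bool
    sym   : ∀ i j → adj i j ≡ adj j i
    irrefl : ∀ i → adj i i ≡ false
open Graph public

VSubset : ℕ → Set
VSubset n = Vec Bool n

-- The induced subgraph G[U]: we keep the vertex set Fin n but only the edges
-- with both endpoints in U (vertices outside U become isolated, hence can
-- lie in no triangle).
induced : ∀ {n} → Graph n → VSubset n → Graph n
induced {n} G U = record
  { adj = λ i j → lookup U i ∧ lookup U j ∧ adj G i j
  ; sym = symProof
  ; irrefl = irr
  }
  where
  open import Data.Bool.Properties using (∧-comm; ∧-zeroʳ)
  open import Relation.Binary.PropositionalEquality using (cong; trans; cong₂)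
  symProof : ∀ i j → (lookup U i ∧ lookup U j ∧ adj G i j) ≡ (lookup U j ∧ lookup U i ∧ adj G j i)
  symProof i j with lookup U i | lookup U j
  ... | true  | true  = Graph.sym G i j
  ... | true  | false = _≡_.refl
  ... | false | true  = _≡_.refl
  ... | false | false = _≡_.refl
  irr : ∀ i → (lookup U i ∧ lookup U i ∧ adj G i i) ≡ false
  irr i with lookup U i
  ... | true  = Graph.irrefl G i
  ... | false = _≡_.refl

triples : ∀ n → List (Fin n × Fin n × Fin n)
triples n = concatMap (λ i → concatMap (λ j → map (λ k → i , j , k) (allFinL n)) (allFinL n)) (allFinL n)

isTriangle : ∀ {n} → Graph n → Fin n × Fin n × Fin n → Bool
isTriangle G (i , j , k) = ⌊ i <? j ⌋ ∧ ⌊ j <? k ⌋ ∧ adj G i j ∧ adj G j k ∧ adj G i k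

triangles : ∀ {n} → Graph n → List (Fin n × Fin n × Fin n)
triangles {n} G = filterᵇ (isTriangle G) (triples n)

triangleCount : ∀ {n} → Graph n → ℕ
triangleCount G = length (triangles G)

hasTriangle : ∀ {n} → Graph n → Bool
hasTriangle {n} G = foldr (λ x b → isTriangle G x ∨ b) false (triples n)

allSubsets : ∀ n → List (VSubset n)
allSubsets zero = [] ∷ []
allSubsets (suc n) = map (true ∷_) (allSubsets n) ++ map (false ∷_) (allSubsets n)

_^ℚ_ : ℚ → ℕ → ℚ
p ^ℚ zero = 1ℚ
p ^ℚ suc k = p * (p ^ℚ k)

size : ∀ {n} → VSubset n → ℕ
size [] = 0
size (true ∷ U) = suc (size U)
size (false ∷ U) = size U

weight : ∀ {n} → ℚ → VSubset n → ℚ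
weight {n} p U = (p ^ℚ size U) * ((1ℚ - p) ^ℚ (n ℕ.∸ size U))

Prob : ∀ n → ℚ → (VSubset n → Bool) → ℚ
Prob n p E = foldr _+_ 0ℚ (map (λ U → if E U then weight p U else 0ℚ) (allSubsets n))

{-# OPTIONS --safe #-}
-- Choose s with 1 ≤ s ≤ t and s p ≤ 1 ≤ (s + 1) p (possible since t p ≥ 1) and let Aᵢ be the
-- event that the i-th of the first s triangles of G lies in U.  Each Aᵢ has probability p³, and
-- two distinct triangles span at least four vertices, so Aᵢ ∧ Aⱼ has probability at most p⁴.
-- The Bonferroni inequality 𝟙[some Aᵢ] ≥ Σᵢ 𝟙[Aᵢ] − Σ_{i<j} 𝟙[Aᵢ ∧ Aⱼ] then bounds the
-- probability that G[U] has a triangle below by s p³ − (s choose 2) p⁴, which for such s is at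
-- least p²/3.
module Submission where

open import Defs hiding (sym)
open import Data.Nat using (ℕ; NonZero)
open import Data.Integer using (+_)
open import Data.Rational using (ℚ; 0ℚ; 1ℚ; _≤_; _*_; _/_)

open import Function using (_∘_; Equivalence)
open import Data.Empty using (⊥-elim)
open import Data.Product using (∃-syntax; _×_; _,_; proj₂)
open import Data.Sum using (inj₁; inj₂)
open import Data.Bool using (Bool; true; false; T; _∧_; _∨_; if_then_else_)
open import Data.Bool.Properties using (T-∧; T-∨)
open import Data.Bool.ListAction using (all; or)
open import Data.Nat as ℕ using (zero; suc)
import Data.Nat.Properties as ℕₚ
import Data.Nat.Coprimality as Coprimality
import Data.Integer as ℤ
import Data.Integer.Properties as ℤₚ
open import Data.Rational using (mkℚ; _+_; _-_; -_; ½; *≤*; _≤?_; nonNegative)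
open import Data.Rational.Properties
open import Data.Rational.Solver using (module +-*-Solver)
open import Data.Fin as Fin using (Fin)
import Data.Fin.Properties as Finₚ
open import Data.Vec using ([]; _∷_; lookup; _[_]≔_)
open import Data.Vec.Properties using (lookup∘update′)
open import Data.List
  using (List; []; _∷_; map; _++_; foldr; length; take; allFin; concatMap; cartesianProduct; cartesianProductWith)
open import Data.List.Properties using (map-∘; map-cong; concatMap-cong; map-concatMap; length-take)
open import Data.List.Relation.Unary.All as All using (All; []; _∷_)
open import Data.List.Relation.Unary.All.Properties using (all⁺; take⁺)
open import Data.List.Relation.Unary.All.Properties.Core using (¬Any⇒All¬; ¬All⇒Any¬)
open import Data.List.Relation.Unary.Any using (here; there)
open import Data.List.Relation.Unary.Any.Properties using (any⁻)
open import Data.List.Relation.Unary.AllPairs using (AllPairs; []; _∷_)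
open import Data.List.Relation.Unary.Unique.Propositional using (Unique)
import Data.List.Relation.Unary.Unique.Propositional.Properties as Uniqueₚ
open import Data.List.Membership.Propositional using (_∈_; _∉_; find)
open import Data.List.Membership.Propositional.Properties using (∈-filter⁻)
import Data.List.Membership.DecPropositional as DecMembership
open import Relation.Nullary using (Dec; yes; no; contradiction)
open import Relation.Nullary.Decidable using (⌊_⌋; toWitness; T?)
open import Relation.Binary.PropositionalEquality
open +-*-Solver

fromℕ : ℕ → ℚ
fromℕ m = mkℚ (+ m) 0 (Coprimality.sym (Coprimality.1-coprimeTo m))

fromℕ-suc : ∀ m → fromℕ (suc m) ≡ 1ℚ + fromℕ m
fromℕ-suc m = trans (sym (normalize-coprime (Coprimality.sym (Coprimality.1-coprimeTo (suc m)))))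
                    (cong (λ z → (+ 1 ℤ.+ z) / 1) (sym (ℤₚ.*-identityʳ (+ m))))

fromℕ-mono-≤ : ∀ {m n} → m ℕ.≤ n → fromℕ m ≤ fromℕ n
fromℕ-mono-≤ {m} {n} m≤n =
  *≤* (subst₂ ℤ._≤_ (sym (ℤₚ.*-identityʳ (+ m))) (sym (ℤₚ.*-identityʳ (+ n))) (ℤ.+≤+ m≤n))

fromℕ-*-mono-≤ : ∀ {p m n} → 0ℚ ≤ p → m ℕ.≤ n → fromℕ m * p ≤ fromℕ n * p
fromℕ-*-mono-≤ {p} 0≤p m≤n = *-monoʳ-≤-nonNeg p {{nonNegative 0≤p}} (fromℕ-mono-≤ m≤n)

fromℕ-suc-* : ∀ m c → c + fromℕ m * c ≡ fromℕ (suc m) * c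
fromℕ-suc-* m c = trans (solve 2 (λ c y → c :+ y :* c := (con 1ℚ :+ y) :* c) refl c (fromℕ m))
                        (cong (_* c) (sym (fromℕ-suc m)))

1/t≤p⇒1≤t*p : ∀ {p} t .{{_ : NonZero t}} → + 1 / t ≤ p → 1ℚ ≤ fromℕ t * p
1/t≤p⇒1≤t*p {p} (suc k) 1/t≤p = subst (_≤ fromℕ (suc k) * p) (*-inverseʳ (fromℕ (suc k)))
  (*-monoˡ-≤-nonNeg (fromℕ (suc k)) (subst (_≤ p) (normalize-coprime (Coprimality.1-coprimeTo (suc k))) 1/t≤p))

choose₂ : ℚ → ℚ
choose₂ y = ½ * (y * (y - 1ℚ))

choose₂-suc-* : ∀ m c → fromℕ m * c + choose₂ (fromℕ m) * c ≡ choose₂ (fromℕ (suc m)) * c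
choose₂-suc-* m c = trans
  (solve 2 (λ y c → y :* c :+ con ½ :* (y :* (y :- con 1ℚ)) :* c
                    := con ½ :* ((con 1ℚ :+ y) :* ((con 1ℚ :+ y) :- con 1ℚ)) :* c) refl (fromℕ m) c)
  (cong (λ y → choose₂ y * c) (sym (fromℕ-suc m)))

*-nonNeg : ∀ {a b} → 0ℚ ≤ a → 0ℚ ≤ b → 0ℚ ≤ a * b
*-nonNeg {a} {b} 0≤a 0≤b =
  nonNegative⁻¹ _ {{nonNeg*nonNeg⇒nonNeg a {{nonNegative 0≤a}} b {{nonNegative 0≤b}}}}

+-nonNeg : ∀ {a b} → 0ℚ ≤ a → 0ℚ ≤ b → 0ℚ ≤ a + b
+-nonNeg = +-mono-≤

p≤q⇒0≤q-p : ∀ {p q} → p ≤ q → 0ℚ ≤ q - p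
p≤q⇒0≤q-p {p} {q} p≤q = subst (_≤ q - p) (+-inverseʳ p) (+-monoˡ-≤ (- p) p≤q)

0≤q⇒p≤p+q : ∀ {p q} → 0ℚ ≤ q → p ≤ p + q
0≤q⇒p≤p+q {p} {q} 0≤q = subst (_≤ p + q) (+-identityʳ p) (+-monoʳ-≤ p 0≤q)

0≤q⇒p-q≤p : ∀ {p q} → 0ℚ ≤ q → p - q ≤ p
0≤q⇒p-q≤p {p} {q} 0≤q = subst (p - q ≤_) (+-identityʳ p) (+-monoʳ-≤ p (neg-antimono-≤ 0≤q))

bracket-1/p : ∀ {p} → 0ℚ ≤ p → p ≤ 1ℚ → ∀ t → 1ℚ ≤ fromℕ t * p →
              ∃[ s ] 1 ℕ.≤ s × s ℕ.≤ t × fromℕ s * p ≤ 1ℚ × 1ℚ ≤ fromℕ (suc s) * p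
bracket-1/p {p} 0≤p p≤1 zero 1≤0 =
  ⊥-elim (<-irrefl refl (<-≤-trans (positive⁻¹ 1ℚ) (subst (1ℚ ≤_) (*-zeroˡ p) 1≤0)))
bracket-1/p {p} 0≤p p≤1 (suc m) 1≤[1+m]p with 1ℚ ≤? fromℕ m * p
... | yes 1≤mp with bracket-1/p 0≤p p≤1 m 1≤mp
...   | s , 1≤s , s≤m , bracketed = s , 1≤s , ℕₚ.m≤n⇒m≤1+n s≤m , bracketed
bracket-1/p {p} 0≤p p≤1 (suc m) 1≤[1+m]p | no 1≰mp with m
...   | zero  = 1 , ℕₚ.≤-refl , ℕₚ.≤-refl , subst (_≤ 1ℚ) (sym (*-identityˡ p)) p≤1 ,
                ≤-trans 1≤[1+m]p (fromℕ-*-mono-≤ 0≤p (ℕₚ.n≤1+n 1))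
...   | suc k = suc k , ℕ.s≤s ℕ.z≤n , ℕₚ.n≤1+n (suc k) , <⇒≤ (≰⇒> 1≰mp) , 1≤[1+m]p

p²/3≤yp³-choose₂[y]p⁴ : ∀ {p y} → 0ℚ ≤ p → 1ℚ ≤ y → y * p ≤ 1ℚ → 1ℚ ≤ (1ℚ + y) * p →
                        + 1 / 3 * (p * p) ≤ y * p ^ℚ 3 - choose₂ y * p ^ℚ 4
p²/3≤yp³-choose₂[y]p⁴ {p} {y} 0≤p 1≤y yp≤1 1≤[1+y]p = begin
    + 1 / 3 * (p * p)
  ≤⟨ 0≤q⇒p≤p+q 0≤slack ⟩
    + 1 / 3 * (p * p) + slack
  ≡⟨ solve 2 (λ p y → con (+ 1 / 3) :* (p :* p)
                       :+ p :* p :* (con ½ :* ((y :- con 1ℚ) :* p :* (con 1ℚ :- y :* p)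
                                               :+ ((con 1ℚ :+ y) :* p :- con 1ℚ))
                                     :+ con (+ 1 / 6))
                    := y :* (p :* (p :* (p :* con 1ℚ)))
                       :- con ½ :* (y :* (y :- con 1ℚ)) :* (p :* (p :* (p :* (p :* con 1ℚ)))))
             refl p y ⟩
    y * p ^ℚ 3 - choose₂ y * p ^ℚ 4
  ∎
  where
  open ≤-Reasoning
  slack : ℚ
  slack = p * p * (½ * ((y - 1ℚ) * p * (1ℚ - y * p) + ((1ℚ + y) * p - 1ℚ)) + + 1 / 6)
  0≤slack : 0ℚ ≤ slack
  0≤slack =
    *-nonNeg (*-nonNeg 0≤p 0≤p)
      (+-nonNeg (*-nonNeg (nonNegative⁻¹ ½)
                          (+-nonNeg (*-nonNeg (*-nonNeg (p≤q⇒0≤q-p 1≤y) 0≤p) (p≤q⇒0≤q-p yp≤1))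
                                    (p≤q⇒0≤q-p 1≤[1+y]p)))
                (nonNegative⁻¹ (+ 1 / 6)))

sumMap : {X : Set} → (X → ℚ) → List X → ℚ
sumMap h xs = foldr _+_ 0ℚ (map h xs)

module _ {X : Set} where

  sumMap-++ : ∀ h (xs ys : List X) → sumMap h (xs ++ ys) ≡ sumMap h xs + sumMap h ys
  sumMap-++ h []       ys = sym (+-identityˡ _)
  sumMap-++ h (x ∷ xs) ys = trans (cong (_+_ (h x)) (sumMap-++ h xs ys)) (sym (+-assoc (h x) _ _))

  sumMap-map : ∀ {Y : Set} h (g : Y → X) ys → sumMap h (map g ys) ≡ sumMap (h ∘ g) ys
  sumMap-map h g ys = cong (foldr _+_ 0ℚ) (sym (map-∘ ys))

  sumMap-cong : ∀ {h k : X → ℚ} → (∀ x → h x ≡ k x) → ∀ xs → sumMap h xs ≡ sumMap k xs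
  sumMap-cong h≗k xs = cong (foldr _+_ 0ℚ) (map-cong h≗k xs)

  sumMap-mono : ∀ {h k : X → ℚ} → (∀ x → h x ≤ k x) → ∀ xs → sumMap h xs ≤ sumMap k xs
  sumMap-mono h≤k []       = ≤-refl
  sumMap-mono h≤k (x ∷ xs) = +-mono-≤ (h≤k x) (sumMap-mono h≤k xs)

  sumMap-*ˡ : ∀ c h (xs : List X) → sumMap (λ x → c * h x) xs ≡ c * sumMap h xs
  sumMap-*ˡ c h []       = sym (*-zeroʳ c)
  sumMap-*ˡ c h (x ∷ xs) =
    trans (cong (_+_ (c * h x)) (sumMap-*ˡ c h xs)) (sym (*-distribˡ-+ c (h x) _))

  sumMap-+ : ∀ h k (xs : List X) → sumMap (λ x → h x + k x) xs ≡ sumMap h xs + sumMap k xs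
  sumMap-+ h k []       = refl
  sumMap-+ h k (x ∷ xs) = trans (cong (_+_ (h x + k x)) (sumMap-+ h k xs))
    (solve 4 (λ a b c d → (a :+ b) :+ (c :+ d) := (a :+ c) :+ (b :+ d)) refl
             (h x) (k x) (sumMap h xs) (sumMap k xs))

  sumMap-− : ∀ h k (xs : List X) → sumMap (λ x → h x - k x) xs ≡ sumMap h xs - sumMap k xs
  sumMap-− h k []       = refl
  sumMap-− h k (x ∷ xs) = trans (cong (_+_ (h x - k x)) (sumMap-− h k xs))
    (solve 4 (λ a b c d → (a :- b) :+ (c :- d) := (a :+ c) :- (b :+ d)) refl
             (h x) (k x) (sumMap h xs) (sumMap k xs))

𝟙 : Bool → ℚ
𝟙 true  = 1ℚ
𝟙 false = 0ℚ

𝟙-nonNeg : ∀ b → 0ℚ ≤ 𝟙 b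
𝟙-nonNeg true  = nonNegative⁻¹ 1ℚ
𝟙-nonNeg false = ≤-refl

𝟙-∧ : ∀ a b → 𝟙 (a ∧ b) ≡ 𝟙 a * 𝟙 b
𝟙-∧ true  b = sym (*-identityˡ (𝟙 b))
𝟙-∧ false b = sym (*-zeroˡ (𝟙 b))

𝟙-mono : ∀ {a b} → (T a → T b) → 𝟙 a ≤ 𝟙 b
𝟙-mono {true}  {true}  _   = ≤-refl
𝟙-mono {true}  {false} a⇒b = ⊥-elim (a⇒b _)
𝟙-mono {false} {b}     _   = 𝟙-nonNeg b

count : List Bool → ℚ
count []       = 0ℚ
count (b ∷ bs) = 𝟙 b + count bs

pairCount : List Bool → ℚ
pairCount []       = 0ℚ
pairCount (b ∷ bs) = 𝟙 b * count bs + pairCount bs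

count-nonNeg : ∀ bs → 0ℚ ≤ count bs
count-nonNeg []       = ≤-refl
count-nonNeg (b ∷ bs) = +-nonNeg (𝟙-nonNeg b) (count-nonNeg bs)

pairCount-nonNeg : ∀ bs → 0ℚ ≤ pairCount bs
pairCount-nonNeg []       = ≤-refl
pairCount-nonNeg (b ∷ bs) = +-nonNeg (*-nonNeg (𝟙-nonNeg b) (count-nonNeg bs)) (pairCount-nonNeg bs)

bonferroni : ∀ bs → count bs - pairCount bs ≤ 𝟙 (or bs)
bonferroni []           = ≤-refl
bonferroni (true ∷ bs)  = begin
    (1ℚ + count bs) - (1ℚ * count bs + pairCount bs)
  ≡⟨ solve 2 (λ c P → (con 1ℚ :+ c) :- (con 1ℚ :* c :+ P) := con 1ℚ :- P) refl (count bs) (pairCount bs) ⟩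
    1ℚ - pairCount bs
  ≤⟨ 0≤q⇒p-q≤p (pairCount-nonNeg bs) ⟩
    1ℚ
  ∎
  where open ≤-Reasoning
bonferroni (false ∷ bs) = begin
    (0ℚ + count bs) - (0ℚ * count bs + pairCount bs)
  ≡⟨ solve 2 (λ c P → (con 0ℚ :+ c) :- (con 0ℚ :* c :+ P) := c :- P) refl (count bs) (pairCount bs) ⟩
    count bs - pairCount bs
  ≤⟨ bonferroni bs ⟩
    𝟙 (or bs)
  ∎
  where open ≤-Reasoning

Invariant : ∀ {n} → Fin n → (VSubset n → ℚ) → Set
Invariant x f = ∀ U b → f (U [ x ]≔ b) ≡ f U

all-lookup-[]≔ : ∀ {n} {x : Fin n} {L} → All (x ≢_) L →
                 ∀ U b → all (lookup (U [ x ]≔ b)) L ≡ all (lookup U) L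
all-lookup-[]≔ []           U b = refl
all-lookup-[]≔ (x≢v ∷ x∉L) U b = cong₂ _∧_ (lookup∘update′ (x≢v ∘ sym) U b) (all-lookup-[]≔ x∉L U b)

size≤n : ∀ {n} (U : VSubset n) → size U ℕ.≤ n
size≤n []          = ℕ.z≤n
size≤n (true ∷ U)  = ℕ.s≤s (size≤n U)
size≤n (false ∷ U) = ℕₚ.m≤n⇒m≤1+n (size≤n U)

AllPairs-mapWithAll : ∀ {A : Set} {P : A → Set} {R S : A → A → Set} →
                      (∀ {x y} → P x → P y → R x y → S x y) →
                      ∀ {xs} → All P xs → AllPairs R xs → AllPairs S xs
AllPairs-mapWithAll f []         []         = []
AllPairs-mapWithAll f (px ∷ pxs) (rx ∷ rxs) =
  All.zipWith (λ (py , r) → f px py r) (pxs , rx) ∷ AllPairs-mapWithAll f pxs rxs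

Triple : ℕ → Set
Triple n = Fin n × Fin n × Fin n

vertices : ∀ {n} → Triple n → List (Fin n)
vertices (i , j , k) = i ∷ j ∷ k ∷ []

Increasing : ∀ {n} → Triple n → Set
Increasing (i , j , k) = i Fin.< j × j Fin.< k

inside : ∀ {n} → Triple n → VSubset n → Bool
inside t U = all (lookup U) (vertices t)

vertices-unique : ∀ {n} {t : Triple n} → Increasing t → Unique (vertices t)
vertices-unique (i<j , j<k) =
  (Finₚ.<⇒≢ i<j ∷ Finₚ.<⇒≢ (Finₚ.<-trans i<j j<k) ∷ []) ∷ (Finₚ.<⇒≢ j<k ∷ []) ∷ [] ∷ []

∈-vertices⇒≤ : ∀ {n} {i j k x : Fin n} → Increasing (i , j , k) → x ∈ vertices (i , j , k) → x Fin.≤ k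
∈-vertices⇒≤ (i<j , j<k) (here refl)                 = ℕₚ.<⇒≤ (Finₚ.<-trans i<j j<k)
∈-vertices⇒≤ (i<j , j<k) (there (here refl))         = ℕₚ.<⇒≤ j<k
∈-vertices⇒≤ (i<j , j<k) (there (there (here refl))) = ℕₚ.≤-refl

vertices-⊆⇒≡ : ∀ {n} {t t′ : Triple n} → Increasing t → Increasing t′ →
               All (_∈ vertices t) (vertices t′) → t′ ≡ t
vertices-⊆⇒≡ _ (i′<j′ , _) (here refl ∷ here refl ∷ _) =
  ⊥-elim (Finₚ.<-irrefl refl i′<j′)
vertices-⊆⇒≡ (i<j , _) (_ , j′<k′) (here refl ∷ there (here refl) ∷ here refl ∷ []) =
  ⊥-elim (Finₚ.<-asym i<j j′<k′)
vertices-⊆⇒≡ _ (_ , j′<k′) (here refl ∷ there (here refl) ∷ there (here refl) ∷ []) =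
  ⊥-elim (Finₚ.<-irrefl refl j′<k′)
vertices-⊆⇒≡ _ _ (here refl ∷ there (here refl) ∷ there (there (here refl)) ∷ []) =
  refl
vertices-⊆⇒≡ t↑ (_ , j′<k′) (here refl ∷ there (there (here refl)) ∷ k′∈t ∷ []) =
  ⊥-elim (ℕₚ.≤⇒≯ (∈-vertices⇒≤ t↑ k′∈t) j′<k′)
vertices-⊆⇒≡ (i<j , _) (i′<j′ , _) (there (here refl) ∷ here refl ∷ _) =
  ⊥-elim (Finₚ.<-asym i<j i′<j′)
vertices-⊆⇒≡ _ (i′<j′ , _) (there (here refl) ∷ there (here refl) ∷ _) =
  ⊥-elim (Finₚ.<-irrefl refl i′<j′)
vertices-⊆⇒≡ t↑ (_ , j′<k′) (there (here refl) ∷ there (there (here refl)) ∷ k′∈t ∷ []) =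
  ⊥-elim (ℕₚ.≤⇒≯ (∈-vertices⇒≤ t↑ k′∈t) j′<k′)
vertices-⊆⇒≡ t↑ (i′<j′ , _) (there (there (here refl)) ∷ j′∈t ∷ _) =
  ⊥-elim (ℕₚ.≤⇒≯ (∈-vertices⇒≤ t↑ j′∈t) i′<j′)

_∈?_ : ∀ {n} (d : Fin n) xs → Dec (d ∈ xs)
d ∈? xs = DecMembership._∈?_ Fin._≟_ d xs

outside-vertex : ∀ {n} {t t′ : Triple n} → Increasing t → Increasing t′ → t′ ≢ t →
                 ∃[ d ] d ∈ vertices t′ × d ∉ vertices t
outside-vertex {t = t} {t′} t↑ t′↑ t′≢t with All.all? (_∈? vertices t) (vertices t′)
... | yes t′⊆t = contradiction (vertices-⊆⇒≡ t↑ t′↑ t′⊆t) t′≢t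
... | no  t′⊈t = find (¬All⇒Any¬ (_∈? vertices t) (vertices t′) t′⊈t)

concatMap-map≡cartesianProductWith : ∀ {A B C : Set} (f : A → B → C) xs ys →
                                     concatMap (λ x → map (f x) ys) xs ≡ cartesianProductWith f xs ys
concatMap-map≡cartesianProductWith f []       ys = refl
concatMap-map≡cartesianProductWith f (x ∷ xs) ys =
  cong (map (f x) ys ++_) (concatMap-map≡cartesianProductWith f xs ys)

triples≡cartesianProduct : ∀ n → triples n ≡ cartesianProduct (allFin n) (cartesianProduct (allFin n) (allFin n))
triples≡cartesianProduct n = begin
    concatMap (λ i → concatMap (λ j → map (λ k → i , j , k) V) V) V
  ≡⟨ concatMap-cong (λ i → trans (concatMap-cong (λ j → map-∘ V) V)
                                 (sym (map-concatMap (i ,_) (λ j → map (j ,_) V) V))) V ⟩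
    concatMap (λ i → map (i ,_) (concatMap (λ j → map (j ,_) V) V)) V
  ≡⟨ concatMap-cong (λ i → cong (map (i ,_)) (concatMap-map≡cartesianProductWith _,_ V V)) V ⟩
    concatMap (λ i → map (i ,_) (cartesianProduct V V)) V
  ≡⟨ concatMap-map≡cartesianProductWith _,_ V (cartesianProduct V V) ⟩
    cartesianProduct V (cartesianProduct V V)
  ∎
  where
  open ≡-Reasoning
  V = allFin n

triangles-unique : ∀ {n} (G : Graph n) → Unique (triangles G)
triangles-unique {n} G = Uniqueₚ.filter⁺ (T? ∘ isTriangle G)
  (subst Unique (sym (triples≡cartesianProduct n))
    (Uniqueₚ.cartesianProduct⁺ V! (Uniqueₚ.cartesianProduct⁺ V! V!)))
  where
  V! = Uniqueₚ.allFin⁺ n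

isTriangle⇒Increasing : ∀ {n} (G : Graph n) t → T (isTriangle G t) → Increasing t
isTriangle⇒Increasing G (i , j , k) tri =
  let i<j , rest = Equivalence.to (T-∧ {⌊ i Fin.<? j ⌋}) tri
      j<k , _    = Equivalence.to (T-∧ {⌊ j Fin.<? k ⌋}) rest
  in toWitness i<j , toWitness j<k

induced-isTriangle : ∀ {n} (G : Graph n) U t →
                     T (inside t U) → T (isTriangle G t) → T (isTriangle (induced G U) t)
induced-isTriangle G U (i , j , k) t⊆U tri with lookup U i | lookup U j | lookup U k
... | true  | true  | true  = tri
... | false | _     | _     = ⊥-elim t⊆U
... | true  | false | _     = ⊥-elim t⊆U
... | true  | true  | false = ⊥-elim t⊆U

T-foldr-∨ : ∀ {X : Set} (f : X → Bool) {x xs} → x ∈ xs → T (f x) → T (foldr (λ y b → f y ∨ b) false xs)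
T-foldr-∨ f (here refl)  fx = Equivalence.from T-∨ (inj₁ fx)
T-foldr-∨ f (there x∈xs) fx = Equivalence.from T-∨ (inj₂ (T-foldr-∨ f x∈xs fx))

hasTriangle-induced : ∀ {n} (G : Graph n) U {t} →
                      t ∈ triangles G → T (inside t U) → T (hasTriangle (induced G U))
hasTriangle-induced {n} G U {t} t∈ t⊆U =
  let t∈triples , tri = ∈-filter⁻ (T? ∘ isTriangle G) {xs = triples n} t∈
  in T-foldr-∨ (isTriangle (induced G U)) t∈triples (induced-isTriangle G U t t⊆U tri)

module Bernoulli (p : ℚ) (0≤p : 0ℚ ≤ p) (p≤1 : p ≤ 1ℚ) where

  weight-true : ∀ {n} (U : VSubset n) → weight p (true ∷ U) ≡ p * weight p U
  weight-true U = *-assoc p _ _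

  weight-false : ∀ {n} (U : VSubset n) → weight p (false ∷ U) ≡ (1ℚ - p) * weight p U
  weight-false {n} U rewrite ℕₚ.+-∸-assoc 1 (size≤n U) =
    solve 3 (λ q a b → a :* (q :* b) := q :* (a :* b)) refl
            (1ℚ - p) (p ^ℚ size U) ((1ℚ - p) ^ℚ (n ℕ.∸ size U))

  weight-nonNeg : ∀ {n} (U : VSubset n) → 0ℚ ≤ weight p U
  weight-nonNeg {n} U = *-nonNeg (^-nonNeg (size U) 0≤p) (^-nonNeg (n ℕ.∸ size U) (p≤q⇒0≤q-p p≤1))
    where
    ^-nonNeg : ∀ {x} k → 0ℚ ≤ x → 0ℚ ≤ x ^ℚ k
    ^-nonNeg zero    0≤x = nonNegative⁻¹ 1ℚ
    ^-nonNeg (suc k) 0≤x = *-nonNeg 0≤x (^-nonNeg k 0≤x)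

  -- Opaque, so that n and f can be recovered from 𝔼 n f by unification.
  opaque
    𝔼 : ∀ n → (VSubset n → ℚ) → ℚ
    𝔼 n f = sumMap (λ U → weight p U * f U) (allSubsets n)

    Prob≡𝔼 : ∀ n E → Prob n p E ≡ 𝔼 n (𝟙 ∘ E)
    Prob≡𝔼 n E = sumMap-cong if≡* (allSubsets n)
      where
      if≡* : ∀ U → (if E U then weight p U else 0ℚ) ≡ weight p U * 𝟙 (E U)
      if≡* U with E U
      ... | true  = sym (*-identityʳ (weight p U))
      ... | false = sym (*-zeroʳ (weight p U))

    𝔼-cong : ∀ {n f g} → (∀ U → f U ≡ g U) → 𝔼 n f ≡ 𝔼 n g
    𝔼-cong {n} f≗g = sumMap-cong (λ U → cong (weight p U *_) (f≗g U)) (allSubsets n)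

    𝔼-mono : ∀ {n f g} → (∀ U → f U ≤ g U) → 𝔼 n f ≤ 𝔼 n g
    𝔼-mono {n} f≤g =
      sumMap-mono (λ U → *-monoˡ-≤-nonNeg (weight p U) {{nonNegative (weight-nonNeg U)}} (f≤g U)) (allSubsets n)

    𝔼-*ˡ : ∀ {n} c f → 𝔼 n (λ U → c * f U) ≡ c * 𝔼 n f
    𝔼-*ˡ {n} c f = trans
      (sumMap-cong (λ U → solve 3 (λ w c a → w :* (c :* a) := c :* (w :* a)) refl (weight p U) c (f U))
                   (allSubsets n))
      (sumMap-*ˡ c _ (allSubsets n))

    𝔼-0 : ∀ {n} → 𝔼 n (λ _ → 0ℚ) ≡ 0ℚ
    𝔼-0 {n} = trans (𝔼-cong {n} (λ _ → sym (*-zeroˡ 0ℚ)))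
                    (trans (𝔼-*ˡ {n} 0ℚ (λ _ → 0ℚ)) (*-zeroˡ (𝔼 n (λ _ → 0ℚ))))

    𝔼-+ : ∀ {n} f g → 𝔼 n (λ U → f U + g U) ≡ 𝔼 n f + 𝔼 n g
    𝔼-+ {n} f g = trans (sumMap-cong (λ U → *-distribˡ-+ (weight p U) (f U) (g U)) (allSubsets n))
                        (sumMap-+ _ _ (allSubsets n))

    𝔼-− : ∀ {n} f g → 𝔼 n (λ U → f U - g U) ≡ 𝔼 n f - 𝔼 n g
    𝔼-− {n} f g = trans
      (sumMap-cong (λ U → solve 3 (λ w a b → w :* (a :- b) := w :* a :- w :* b) refl (weight p U) (f U) (g U))
                   (allSubsets n))
      (sumMap-− _ _ (allSubsets n))

    𝔼-suc : ∀ n f → 𝔼 (suc n) f ≡ p * 𝔼 n (f ∘ (true ∷_)) + (1ℚ - p) * 𝔼 n (f ∘ (false ∷_))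
    𝔼-suc n f = begin
        sumMap g (map (true ∷_) A ++ map (false ∷_) A)
      ≡⟨ sumMap-++ g (map (true ∷_) A) (map (false ∷_) A) ⟩
        sumMap g (map (true ∷_) A) + sumMap g (map (false ∷_) A)
      ≡⟨ cong₂ _+_ (sumMap-map g _ A) (sumMap-map g _ A) ⟩
        sumMap (g ∘ (true ∷_)) A + sumMap (g ∘ (false ∷_)) A
      ≡⟨ cong₂ _+_ (branch true {p} weight-true) (branch false {1ℚ - p} weight-false) ⟩
        p * 𝔼 n (f ∘ (true ∷_)) + (1ℚ - p) * 𝔼 n (f ∘ (false ∷_))
      ∎
      where
      open ≡-Reasoning
      A : List (VSubset n)
      A = allSubsets n
      g : VSubset (suc n) → ℚ
      g U = weight p U * f U
      branch : ∀ b {c} → (∀ (U : VSubset n) → weight p (b ∷ U) ≡ c * weight p U) →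
               sumMap (g ∘ (b ∷_)) A ≡ c * 𝔼 n (f ∘ (b ∷_))
      branch b {c} w =
        trans (sumMap-cong (λ U → trans (cong (_* f (b ∷ U)) (w U)) (*-assoc c _ _)) A) (sumMap-*ˡ c _ A)

    𝔼-1 : ∀ n → 𝔼 n (λ _ → 1ℚ) ≡ 1ℚ
    𝔼-1 zero    = refl
    𝔼-1 (suc n) = begin
        𝔼 (suc n) (λ _ → 1ℚ)
      ≡⟨ 𝔼-suc n _ ⟩
        p * 𝔼 n (λ _ → 1ℚ) + (1ℚ - p) * 𝔼 n (λ _ → 1ℚ)
      ≡⟨ cong (λ e → p * e + (1ℚ - p) * e) (𝔼-1 n) ⟩
        p * 1ℚ + (1ℚ - p) * 1ℚ
      ≡⟨ solve 1 (λ p → p :* con 1ℚ :+ (con 1ℚ :- p) :* con 1ℚ := con 1ℚ) refl p ⟩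
        1ℚ
      ∎
      where open ≡-Reasoning

  𝔼-𝟙-lookup-* : ∀ {n} (x : Fin n) f → Invariant x f → 𝔼 n (λ U → 𝟙 (lookup U x) * f U) ≡ p * 𝔼 n f
  𝔼-𝟙-lookup-* {suc n} Fin.zero f inv = begin
      𝔼 (suc n) (λ U → 𝟙 (lookup U Fin.zero) * f U)
    ≡⟨ 𝔼-suc n _ ⟩
      p * 𝔼 n (λ U → 1ℚ * f (true ∷ U)) + (1ℚ - p) * 𝔼 n (λ U → 0ℚ * f (false ∷ U))
    ≡⟨ cong₂ (λ a b → p * a + (1ℚ - p) * b) (𝔼-cong (λ U → *-identityˡ _))
                                            (trans (𝔼-*ˡ 0ℚ (f ∘ (false ∷_))) (*-zeroˡ B)) ⟩
      p * A + (1ℚ - p) * 0ℚ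
    ≡⟨ solve 2 (λ p A → p :* A :+ (con 1ℚ :- p) :* con 0ℚ := p :* (p :* A :+ (con 1ℚ :- p) :* A)) refl p A ⟩
      p * (p * A + (1ℚ - p) * A)
    ≡⟨ cong (λ C → p * (p * A + (1ℚ - p) * C)) (𝔼-cong (λ U → inv (false ∷ U) true)) ⟩
      p * (p * A + (1ℚ - p) * B)
    ≡⟨ cong (p *_) (sym (𝔼-suc n f)) ⟩
      p * 𝔼 (suc n) f
    ∎
    where
    open ≡-Reasoning
    A = 𝔼 n (f ∘ (true ∷_))
    B = 𝔼 n (f ∘ (false ∷_))
  𝔼-𝟙-lookup-* {suc n} (Fin.suc x) f inv = begin
      𝔼 (suc n) (λ U → 𝟙 (lookup U (Fin.suc x)) * f U)
    ≡⟨ 𝔼-suc n _ ⟩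
      p * 𝔼 n (λ U → 𝟙 (lookup U x) * f (true ∷ U)) + (1ℚ - p) * 𝔼 n (λ U → 𝟙 (lookup U x) * f (false ∷ U))
    ≡⟨ cong₂ (λ a b → p * a + (1ℚ - p) * b) (𝔼-𝟙-lookup-* x _ (λ U → inv (true ∷ U)))
                                            (𝔼-𝟙-lookup-* x _ (λ U → inv (false ∷ U))) ⟩
      p * (p * A) + (1ℚ - p) * (p * B)
    ≡⟨ solve 3 (λ p A B → p :* (p :* A) :+ (con 1ℚ :- p) :* (p :* B) := p :* (p :* A :+ (con 1ℚ :- p) :* B))
               refl p A B ⟩
      p * (p * A + (1ℚ - p) * B)
    ≡⟨ cong (p *_) (sym (𝔼-suc n f)) ⟩
      p * 𝔼 (suc n) f
    ∎
    where
    open ≡-Reasoning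
    A = 𝔼 n (f ∘ (true ∷_))
    B = 𝔼 n (f ∘ (false ∷_))

  𝔼-𝟙-all : ∀ {n} (L : List (Fin n)) → Unique L → 𝔼 n (λ U → 𝟙 (all (lookup U) L)) ≡ p ^ℚ length L
  𝔼-𝟙-all []      []            = 𝔼-1 _
  𝔼-𝟙-all (x ∷ L) (x∉L ∷ uniq) = begin
      𝔼 _ (λ U → 𝟙 (lookup U x ∧ all (lookup U) L))
    ≡⟨ 𝔼-cong (λ U → 𝟙-∧ (lookup U x) _) ⟩
      𝔼 _ (λ U → 𝟙 (lookup U x) * 𝟙 (all (lookup U) L))
    ≡⟨ 𝔼-𝟙-lookup-* x _ (λ U b → cong 𝟙 (all-lookup-[]≔ x∉L U b)) ⟩
      p * 𝔼 _ (λ U → 𝟙 (all (lookup U) L))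
    ≡⟨ cong (p *_) (𝔼-𝟙-all L uniq) ⟩
      p ^ℚ length (x ∷ L)
    ∎
    where open ≡-Reasoning

  module _ {n : ℕ} {X : Set} (E : X → VSubset n → Bool) where

    𝔼-count : ∀ {c} xs → All (λ x → 𝔼 n (𝟙 ∘ E x) ≡ c) xs →
              𝔼 n (λ U → count (map (λ x → E x U) xs)) ≡ fromℕ (length xs) * c
    𝔼-count {c} []       []         = trans 𝔼-0 (sym (*-zeroˡ c))
    𝔼-count {c} (x ∷ xs) (𝔼x ∷ 𝔼xs) =
      trans (𝔼-+ _ _) (trans (cong₂ _+_ 𝔼x (𝔼-count xs 𝔼xs)) (fromℕ-suc-* (length xs) c))

    𝔼-*-count : ∀ {c} (f : VSubset n → ℚ) ys → All (λ y → 𝔼 n (λ U → f U * 𝟙 (E y U)) ≤ c) ys →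
                𝔼 n (λ U → f U * count (map (λ y → E y U) ys)) ≤ fromℕ (length ys) * c
    𝔼-*-count {c} f [] [] =
      ≤-reflexive (trans (trans (𝔼-cong (λ U → *-zeroʳ (f U))) 𝔼-0) (sym (*-zeroˡ c)))
    𝔼-*-count {c} f (y ∷ ys) (𝔼y ∷ 𝔼ys) = begin
        𝔼 n (λ U → f U * (𝟙 (E y U) + count (map (λ y → E y U) ys)))
      ≡⟨ trans (𝔼-cong (λ U → *-distribˡ-+ (f U) _ _)) (𝔼-+ _ _) ⟩
        𝔼 n (λ U → f U * 𝟙 (E y U)) + 𝔼 n (λ U → f U * count (map (λ y → E y U) ys))
      ≤⟨ +-mono-≤ 𝔼y (𝔼-*-count f ys 𝔼ys) ⟩
        c + fromℕ (length ys) * c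
      ≡⟨ fromℕ-suc-* (length ys) c ⟩
        fromℕ (length (y ∷ ys)) * c
      ∎
      where open ≤-Reasoning

    𝔼-pairCount : ∀ {c} xs → AllPairs (λ x y → 𝔼 n (λ U → 𝟙 (E x U) * 𝟙 (E y U)) ≤ c) xs →
                  𝔼 n (λ U → pairCount (map (λ x → E x U) xs)) ≤ choose₂ (fromℕ (length xs)) * c
    𝔼-pairCount {c} []       []         = ≤-reflexive (trans 𝔼-0 (sym (*-zeroˡ c)))
    𝔼-pairCount {c} (x ∷ xs) (𝔼x ∷ 𝔼xs) = begin
        𝔼 n (λ U → 𝟙 (E x U) * count (map (λ y → E y U) xs) + pairCount (map (λ y → E y U) xs))
      ≡⟨ 𝔼-+ _ _ ⟩
        𝔼 n (λ U → 𝟙 (E x U) * count (map (λ y → E y U) xs)) + 𝔼 n (λ U → pairCount (map (λ y → E y U) xs))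
      ≤⟨ +-mono-≤ (𝔼-*-count (𝟙 ∘ E x) xs 𝔼x) (𝔼-pairCount xs 𝔼xs) ⟩
        fromℕ (length xs) * c + choose₂ (fromℕ (length xs)) * c
      ≡⟨ choose₂-suc-* (length xs) c ⟩
        choose₂ (fromℕ (length (x ∷ xs))) * c
      ∎
      where open ≤-Reasoning

  𝔼-inside : ∀ {n} {t : Triple n} → Increasing t → 𝔼 n (𝟙 ∘ inside t) ≡ p ^ℚ 3
  𝔼-inside t↑ = 𝔼-𝟙-all (vertices _) (vertices-unique t↑)

  𝔼-inside-pair : ∀ {n} {t t′ : Triple n} → Increasing t → Increasing t′ → t ≢ t′ →
                  𝔼 n (λ U → 𝟙 (inside t U) * 𝟙 (inside t′ U)) ≤ p ^ℚ 4
  𝔼-inside-pair {n} {t} {t′} t↑ t′↑ t≢t′ with outside-vertex t↑ t′↑ (t≢t′ ∘ sym)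
  ... | d , d∈t′ , d∉t = begin
      𝔼 n (λ U → 𝟙 (inside t U) * 𝟙 (inside t′ U))
    ≡⟨ 𝔼-cong (λ U → sym (𝟙-∧ (inside t U) (inside t′ U))) ⟩
      𝔼 n (λ U → 𝟙 (inside t U ∧ inside t′ U))
    ≤⟨ 𝔼-mono (λ U → 𝟙-mono (d∈U U)) ⟩
      𝔼 n (λ U → 𝟙 (all (lookup U) (d ∷ vertices t)))
    ≡⟨ 𝔼-𝟙-all (d ∷ vertices t) (¬Any⇒All¬ (vertices t) d∉t ∷ vertices-unique t↑) ⟩
      p ^ℚ 4
    ∎
    where
    open ≤-Reasoning
    d∈U : ∀ U → T (inside t U ∧ inside t′ U) → T (lookup U d ∧ inside t U)
    d∈U U both =
      let t⊆U , t′⊆U = Equivalence.to (T-∧ {inside t U}) both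
      in Equivalence.from T-∧ (All.lookup (all⁺ (lookup U) (vertices t′) t′⊆U) d∈t′ , t⊆U)

  Prob-hasTriangle-≥ : ∀ {n} (G : Graph n) ts → Unique ts → All (_∈ triangles G) ts →
                       fromℕ (length ts) * p ^ℚ 3 - choose₂ (fromℕ (length ts)) * p ^ℚ 4
                         ≤ Prob n p (λ U → hasTriangle (induced G U))
  Prob-hasTriangle-≥ {n} G ts uniq ts⊆ = begin
      fromℕ (length ts) * p ^ℚ 3 - choose₂ (fromℕ (length ts)) * p ^ℚ 4
    ≤⟨ +-monoʳ-≤ (fromℕ (length ts) * p ^ℚ 3) (neg-antimono-≤ (𝔼-pairCount inside ts pairs≤)) ⟩
      fromℕ (length ts) * p ^ℚ 3 - 𝔼 n (pairCount ∘ occurring)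
    ≡⟨ cong (_- 𝔼 n (pairCount ∘ occurring)) (sym (𝔼-count inside ts (All.map 𝔼-inside increasing))) ⟩
      𝔼 n (count ∘ occurring) - 𝔼 n (pairCount ∘ occurring)
    ≡⟨ sym (𝔼-− _ _) ⟩
      𝔼 n (λ U → count (occurring U) - pairCount (occurring U))
    ≤⟨ 𝔼-mono (λ U → ≤-trans (bonferroni (occurring U)) (𝟙-mono (some-inside⇒hasTriangle U))) ⟩
      𝔼 n (𝟙 ∘ hasTriangle ∘ induced G)
    ≡⟨ sym (Prob≡𝔼 n _) ⟩
      Prob n p (λ U → hasTriangle (induced G U))
    ∎
    where
    open ≤-Reasoning
    occurring : VSubset n → List Bool
    occurring U = map (λ t → inside t U) ts
    increasing : All Increasing ts
    increasing = All.map (λ t∈ → isTriangle⇒Increasing G _ (proj₂ (∈-filter⁻ _ {xs = triples n} t∈))) ts⊆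
    pairs≤ : AllPairs (λ t t′ → 𝔼 n (λ U → 𝟙 (inside t U) * 𝟙 (inside t′ U)) ≤ p ^ℚ 4) ts
    pairs≤ = AllPairs-mapWithAll 𝔼-inside-pair increasing uniq
    some-inside⇒hasTriangle : ∀ U → T (or (occurring U)) → T (hasTriangle (induced G U))
    some-inside⇒hasTriangle U h =
      let t , t∈ts , t⊆U = find (any⁻ (λ t → inside t U) ts h)
      in hasTriangle-induced G U (All.lookup ts⊆ t∈ts) t⊆U

claim12 : (n : ℕ) (G : Graph n) (p : ℚ) → 0ℚ ≤ p → p ≤ 1ℚ
          → .{{_ : NonZero (triangleCount G)}}
          → (+ 1) / triangleCount G ≤ p
          → (+ 1 / 3) * (p * p) ≤ Prob n p (λ U → hasTriangle (induced G U))
claim12 n G p 0≤p p≤1 1/t≤p with bracket-1/p 0≤p p≤1 (triangleCount G) (1/t≤p⇒1≤t*p (triangleCount G) 1/t≤p)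
... | s , 1≤s , s≤t , sp≤1 , 1≤[1+s]p = begin
    + 1 / 3 * (p * p)
  ≤⟨ p²/3≤yp³-choose₂[y]p⁴ 0≤p (fromℕ-mono-≤ 1≤s) sp≤1 (subst (λ y → 1ℚ ≤ y * p) (fromℕ-suc s) 1≤[1+s]p) ⟩
    fromℕ s * p ^ℚ 3 - choose₂ (fromℕ s) * p ^ℚ 4
  ≡⟨ cong (λ m → fromℕ m * p ^ℚ 3 - choose₂ (fromℕ m) * p ^ℚ 4) (sym |ts|≡s) ⟩
    fromℕ (length ts) * p ^ℚ 3 - choose₂ (fromℕ (length ts)) * p ^ℚ 4
  ≤⟨ Prob-hasTriangle-≥ G ts (Uniqueₚ.take⁺ s (triangles-unique G)) (take⁺ s (All.tabulate (λ t∈ → t∈))) ⟩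
    Prob n p (λ U → hasTriangle (induced G U))
  ∎
  where
  open Bernoulli p 0≤p p≤1
  open ≤-Reasoning
  ts : List (Triple n)
  ts = take s (triangles G)
  |ts|≡s : length ts ≡ s
  |ts|≡s = trans (length-take s (triangles G)) (ℕₚ.m≤n⇒m⊓n≡m s≤t)
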